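{- (Strengthening) Let $A,B$ be formulas and $\Phi,\Psi$ constraint sets. If $A\le_\Phi B$ and $\Psi\models\Phi$, then $A\le_\Psi B$. (Transitivity) If $A\le_\Phi B$ and $B\le_\Phi C$, then $A\le_\Phi C$.
   Context: Resource polynomials: finite sums of finite products $\prod_i\binom{x_i}{n_i}$ (pairwise distinct variables $x_i$, $n_i\in\mathbb{N}$), read as functions of natural-number variables. A constraint is $p\le q$ for resource polynomials $p,q$; $p<q$ abbreviates $p+1\le q$; a constraint set is a finite set of constraints. $\Phi\models c$ means every assignment of naturals to variables satisfying all of $\Phi$ satisfies $c$; $\Phi\models\Psi$ means $\Phi\models c$ for all $c\in\Psi$; $p\sqsubseteq_\Phi q$ means $\Phi\models p\le q$. Formulas: $A::=\alpha(p_1,\dots,p_n)\mid A\otimes A\mid A\multimap A\mid\forall\alpha.A\mid\,!_{x<p}A\mid\forall(x_1,\dots,x_n){:}\Phi.A\mid\exists(x_1,\dots,x_n){:}\Phi.A$, where $\alpha$ ranges over atoms each with a fixed arity $n$, the $p_i,p$ are resource polynomials, $x\notin FV(p)$, $\Phi$ is a constraint set, and (boundedness) for each quantifier formula there are resource polynomials $r_1,\dots,r_n$ not containing $x_1,\dots,x_n$ with $\Phi\models\{x_1\le r_1,\dots,x_n\le r_n\}$. $!_{x<p}$ binds $x$ in its body, first-order quantifiers bind $\overline{x}$ in $\Phi$ and in the body, $\forall\alpha$ binds $\alpha$; formulas are identified up to renaming of bound variables. Order on formulas relative to a constraint set $\Phi$ (only formulas with the same shape are comparable): $\alpha(\overline{p})\le_\Phi\alpha(\overline{q})$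 iff $p_i\sqsubseteq_\Phi q_i$ for all $i$; $A\otimes B\le_\Phi C\otimes D$ iff $A\le_\Phi C$ and $B\le_\Phi D$; $A\multimap B\le_\Phi C\multimap D$ iff $C\le_\Phi A$ and $B\le_\Phi D$; $\forall\alpha.A\le_\Phi\forall\alpha.B$ iff $A\le_\Phi B$; $!_{x<p}A\le_\Phi\,!_{x<q}B$ iff $q\sqsubseteq_\Phi p$, $x\notin FV(\Phi)$ and $A\le_{\Phi\cup\{x<q\}}B$; $\forall\overline{x}{:}\Psi.A\le_\Phi\forall\overline{x}{:}\Theta.B$ iff $\Phi\cup\Theta\models\Psi$, $\overline{x}\notin FV(\Phi)$ and $A\le_{\Phi\cup\Theta}B$; $\exists\overline{x}{:}\Psi.A\le_\Phi\exists\overline{x}{:}\Theta.B$ iff $\Phi\cup\Psi\models\Theta$, $\overline{x}\notin FV(\Phi)$ and $A\le_{\Phi\cup\Psi}B$. -}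

module Defs where

open import Data.Nat using (ℕ; zero; suc; _+_; _*_; _≤_)
open import Data.Nat.Combinatorics using (_C_)
open import Data.Product using (_×_; _,_; proj₁; Σ)
open import Data.List using (List; []; _∷_; map; _++_; [_])
open import Data.List.Relation.Unary.All using (All)
open import Data.List.Relation.Unary.Unique.Propositional using (Unique)
open import Data.List.Membership.Propositional using (_∈_)
open import Data.Vec using (Vec; lookup)
open import Data.Vec.Relation.Binary.Pointwise.Inductive using (Pointwise)
open import Data.Fin using (Fin; toℕ)

-- First-order variables are de Bruijn indices (natural numbers).
-- Binders shift indices; this realises "identified up to renaming".

Var : Set
Var = ℕ

-- A monomial  ∏ binom(x_i, n_i)  is a list of pairs (x_i , n_i).
Mono : Set
Mono = List (Var × ℕ)

RP : Set
RP = List Mono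

WFP : RP → Set
WFP p = All (λ m → Unique (map proj₁ m)) p

Assign : Set
Assign = Var → ℕ

⟦_⟧m : Mono → Assign → ℕ
⟦ [] ⟧m ρ = 1
⟦ (x , n) ∷ m ⟧m ρ = (ρ x C n) * ⟦ m ⟧m ρ

⟦_⟧ : RP → Assign → ℕ
⟦ [] ⟧ ρ = 0
⟦ m ∷ p ⟧ ρ = ⟦ m ⟧m ρ + ⟦ p ⟧ ρ

var : Var → RP
var x = [ [ (x , 1) ] ]

one : RP
one = [ [] ]

_⊕_ : RP → RP → RP
p ⊕ q = p ++ q

-- shifting all variables by k (weakening under k binders)
wkM : ℕ → Mono → Mono
wkM k = map (λ { (x , n) → (k + x , n) })

wk : ℕ → RP → RP
wk k = map (wkM k)

record Constraint : Set where
  constructor _≤ᶜ_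
  field
    lhs rhs : RP
open Constraint public

_<ᶜ_ : RP → RP → Constraint
p <ᶜ q = (p ⊕ one) ≤ᶜ q

Constraints : Set
Constraints = List Constraint

WFC : Constraint → Set
WFC (p ≤ᶜ q) = WFP p × WFP q

WFCs : Constraints → Set
WFCs = All WFC

wkC : ℕ → Constraint → Constraint
wkC k (p ≤ᶜ q) = wk k p ≤ᶜ wk k q

wkCs : ℕ → Constraints → Constraints
wkCs k = map (wkC k)

Holds : Assign → Constraint → Set
Holds ρ (p ≤ᶜ q) = ⟦ p ⟧ ρ ≤ ⟦ q ⟧ ρ

Sat : Assign → Constraints → Set
Sat ρ Φ = All (Holds ρ) Φ

_⊨_ : Constraints → Constraint → Set
Φ ⊨ c = (ρ : Assign) → Sat ρ Φ → Holds ρ c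

_⊨*_ : Constraints → Constraints → Set
Φ ⊨* Ψ = All (Φ ⊨_) Ψ

_⊑[_]_ : RP → Constraints → RP → Set
p ⊑[ Φ ] q = Φ ⊨ (p ≤ᶜ q)

-- Indexed by the context Γ of arities of the atoms in scope;
-- atoms (second-order variables) are de Bruijn positions n ∈ Γ, applied
-- to exactly n polynomials.
--   !  p A        :  !_{x<p} A          (x = variable 0 in A)
--   ∀ᶠ k Φ A      :  ∀(x_1..x_k):Φ. A   (x_i = variables 0..k-1 in Φ, A)
--   ∃ᶠ k Φ A      :  ∃(x_1..x_k):Φ. A
--   ∀ᵃ n A        :  ∀α.A with α of arity n

infixr 6 _⊗_
infixr 5 _⊸_

data Formula (Γ : List ℕ) : Set where
  atom : ∀ {n} → n ∈ Γ → Vec RP n → Formula Γ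
  _⊗_  : Formula Γ → Formula Γ → Formula Γ
  _⊸_  : Formula Γ → Formula Γ → Formula Γ
  ∀ᵃ   : (n : ℕ) → Formula (n ∷ Γ) → Formula Γ
  !    : RP → Formula Γ → Formula Γ
  ∀ᶠ   : (k : ℕ) → Constraints → Formula Γ → Formula Γ
  ∃ᶠ   : (k : ℕ) → Constraints → Formula Γ → Formula Γ

-- Boundedness of a quantifier binding variables 0..k-1 with constraints Φ:
-- there are resource polynomials r_1..r_k not containing the bound
-- variables (i.e. weakenings by k) such that Φ ⊨ x_i ≤ r_i.
Bounded : ℕ → Constraints → Set
Bounded k Φ = Σ (Vec RP k) λ r →
  ((i : Fin k) → WFP (lookup r i)) ×
  ((i : Fin k) → Φ ⊨ (var (toℕ i) ≤ᶜ wk k (lookup r i)))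

WF : ∀ {Γ} → Formula Γ → Set
WF (atom x ps) = Data.Vec.Relation.Unary.All.All WFP ps
  where import Data.Vec.Relation.Unary.All
WF (A ⊗ B) = WF A × WF B
WF (A ⊸ B) = WF A × WF B
WF (∀ᵃ n A) = WF A
WF (! p A) = WFP p × WF A
WF (∀ᶠ k Φ A) = WFCs Φ × Bounded k Φ × WF A
WF (∃ᶠ k Φ A) = WFCs Φ × Bounded k Φ × WF A

infix 4 _≤[_]_

data _≤[_]_ {Γ : List ℕ} : Formula Γ → Constraints → Formula Γ → Set where
  atom≤ : ∀ {Φ n} {x : n ∈ Γ} {ps qs : Vec RP n} →
          Pointwise (λ p q → p ⊑[ Φ ] q) ps qs →
          atom x ps ≤[ Φ ] atom x qs
  ⊗≤    : ∀ {Φ A B C D} → A ≤[ Φ ] C → B ≤[ Φ ] D → (A ⊗ B) ≤[ Φ ] (C ⊗ D)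
  ⊸≤    : ∀ {Φ A B C D} → C ≤[ Φ ] A → B ≤[ Φ ] D → (A ⊸ B) ≤[ Φ ] (C ⊸ D)
  ∀ᵃ≤   : ∀ {Φ n} {A B : Formula (n ∷ Γ)} → A ≤[ Φ ] B → ∀ᵃ n A ≤[ Φ ] ∀ᵃ n B
  !≤    : ∀ {Φ p q A B} → q ⊑[ Φ ] p →
          A ≤[ wkCs 1 Φ ++ [ var 0 <ᶜ wk 1 q ] ] B →
          ! p A ≤[ Φ ] ! q B
  ∀ᶠ≤   : ∀ {Φ k Ψ Θ A B} → (wkCs k Φ ++ Θ) ⊨* Ψ →
          A ≤[ wkCs k Φ ++ Θ ] B →
          ∀ᶠ k Ψ A ≤[ Φ ] ∀ᶠ k Θ B
  ∃ᶠ≤   : ∀ {Φ k Ψ Θ A B} → (wkCs k Φ ++ Ψ) ⊨* Θ →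
          A ≤[ wkCs k Φ ++ Ψ ] B →
          ∃ᶠ k Ψ A ≤[ Φ ] ∃ᶠ k Θ B

module Submission where

open import Defs
open import Function using (id; _∘_)
open import Data.Nat using (ℕ; _+_; _*_; _≤_)
open import Data.Nat.Combinatorics using (_C_)
import Data.Nat.Properties as ℕ
open import Data.List using (List; []; _∷_; _++_; [_])
open import Data.List.Relation.Unary.All using ([]; _∷_; head)
import Data.List.Relation.Unary.All as All
open import Data.List.Relation.Unary.All.Properties using (++⁺; ++⁻ˡ; ++⁻ʳ; map⁺; map⁻)
open import Data.Product using (_×_; _,_)
import Data.Vec.Relation.Binary.Pointwise.Inductive as Pointwise
open import Relation.Binary.PropositionalEquality using (_≡_; refl; cong; cong₂; subst; sym)

-- Apart from
-- bookkeeping, all that is needed is that semantic entailment between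
-- constraint sets is a preorder that is preserved by weakening under binders.

⊨*⇒Sat : ∀ {Ψ Φ} → Ψ ⊨* Φ → ∀ ρ → Sat ρ Ψ → Sat ρ Φ
⊨*⇒Sat Ψ⊨Φ ρ ρ⊨Ψ = All.map (λ Ψ⊨c → Ψ⊨c ρ ρ⊨Ψ) Ψ⊨Φ

Sat⇒⊨* : ∀ {Ψ} Φ → (∀ ρ → Sat ρ Ψ → Sat ρ Φ) → Ψ ⊨* Φ
Sat⇒⊨* []      _     = []
Sat⇒⊨* (c ∷ Φ) entail =
  (λ ρ → head ∘ entail ρ) ∷ Sat⇒⊨* Φ (λ ρ → All.tail ∘ entail ρ)

⊨-trans : ∀ {Ψ Φ c} → Ψ ⊨* Φ → Φ ⊨ c → Ψ ⊨ c
⊨-trans Ψ⊨Φ Φ⊨c ρ = Φ⊨c ρ ∘ ⊨*⇒Sat Ψ⊨Φ ρ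

⊨*-trans : ∀ {Ψ Φ Θ} → Ψ ⊨* Φ → Φ ⊨* Θ → Ψ ⊨* Θ
⊨*-trans Ψ⊨Φ = All.map (λ {c} → ⊨-trans {c = c} Ψ⊨Φ)

⊨*-refl : ∀ Φ → Φ ⊨* Φ
⊨*-refl Φ = Sat⇒⊨* Φ (λ _ → id)

⊨*-++ˡ : ∀ Φ {Θ} → (Φ ++ Θ) ⊨* Φ
⊨*-++ˡ Φ = Sat⇒⊨* Φ (λ _ → ++⁻ˡ Φ)

⊨*-++ʳ : ∀ Φ {Θ} → (Φ ++ Θ) ⊨* Θ
⊨*-++ʳ Φ {Θ} = Sat⇒⊨* Θ (λ _ → ++⁻ʳ Φ)

⊑-trans : ∀ {Φ p q r} → p ⊑[ Φ ] q → q ⊑[ Φ ] r → p ⊑[ Φ ] r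
⊑-trans p⊑q q⊑r ρ ρ⊨Φ = ℕ.≤-trans (p⊑q ρ ρ⊨Φ) (q⊑r ρ ρ⊨Φ)

⟦wkM⟧ : ∀ k m ρ → ⟦ wkM k m ⟧m ρ ≡ ⟦ m ⟧m (ρ ∘ (k +_))
⟦wkM⟧ k []            ρ = refl
⟦wkM⟧ k ((x , n) ∷ m) ρ = cong ((ρ (k + x) C n) *_) (⟦wkM⟧ k m ρ)

⟦wk⟧ : ∀ k p ρ → ⟦ wk k p ⟧ ρ ≡ ⟦ p ⟧ (ρ ∘ (k +_))
⟦wk⟧ k []      ρ = refl
⟦wk⟧ k (m ∷ p) ρ = cong₂ _+_ (⟦wkM⟧ k m ρ) (⟦wk⟧ k p ρ)

Holds-wkC : ∀ k c ρ → Holds ρ (wkC k c) ≡ Holds (ρ ∘ (k +_)) c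
Holds-wkC k (p ≤ᶜ q) ρ = cong₂ _≤_ (⟦wk⟧ k p ρ) (⟦wk⟧ k q ρ)

Sat-wkCs⁻ : ∀ k Φ ρ → Sat ρ (wkCs k Φ) → Sat (ρ ∘ (k +_)) Φ
Sat-wkCs⁻ k Φ ρ = All.map (λ {c} → subst id (Holds-wkC k c ρ)) ∘ map⁻

⊨-wkC : ∀ k {Φ c} → Φ ⊨ c → wkCs k Φ ⊨ wkC k c
⊨-wkC k {Φ} {c} Φ⊨c ρ =
  subst id (sym (Holds-wkC k c ρ)) ∘ Φ⊨c (ρ ∘ (k +_)) ∘ Sat-wkCs⁻ k Φ ρ

⊨*-wkCs : ∀ k {Ψ Φ} → Ψ ⊨* Φ → wkCs k Ψ ⊨* wkCs k Φ
⊨*-wkCs k = map⁺ ∘ All.map (λ {c} → ⊨-wkC k {c = c})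

⊨*-under : ∀ k {Ψ Φ Ξ Θ} → Ψ ⊨* Φ → (wkCs k Ψ ++ Ξ) ⊨* Θ →
           (wkCs k Ψ ++ Ξ) ⊨* (wkCs k Φ ++ Θ)
⊨*-under k {Ψ} Ψ⊨Φ ⊨Θ = ++⁺ (⊨*-trans (⊨*-++ˡ (wkCs k Ψ)) (⊨*-wkCs k Ψ⊨Φ)) ⊨Θ

⊨*-under-same : ∀ k {Ψ Φ} Θ → Ψ ⊨* Φ → (wkCs k Ψ ++ Θ) ⊨* (wkCs k Φ ++ Θ)
⊨*-under-same k {Ψ} Θ Ψ⊨Φ = ⊨*-under k Ψ⊨Φ (⊨*-++ʳ (wkCs k Ψ))

<-bound-mono : ∀ {Ψ r q} → r ⊑[ Ψ ] q →
               (wkCs 1 Ψ ++ [ var 0 <ᶜ wk 1 r ]) ⊨* [ var 0 <ᶜ wk 1 q ]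
<-bound-mono {Ψ} {r} {q} r⊑q = (λ ρ ρ⊨Ψ₊ →
  ℕ.≤-trans (head (++⁻ʳ (wkCs 1 Ψ) ρ⊨Ψ₊))
            (⊨-wkC 1 {c = r ≤ᶜ q} r⊑q ρ (++⁻ˡ (wkCs 1 Ψ) ρ⊨Ψ₊))) ∷ []

≤-strengthen : ∀ {Γ} {A B : Formula Γ} {Φ Ψ} → Ψ ⊨* Φ → A ≤[ Φ ] B → A ≤[ Ψ ] B
≤-strengthen Ψ⊨Φ (atom≤ ps⊑qs) = atom≤ (Pointwise.map (λ {p} {q} → ⊨-trans {c = p ≤ᶜ q} Ψ⊨Φ) ps⊑qs)
≤-strengthen Ψ⊨Φ (⊗≤ A≤C B≤D) = ⊗≤ (≤-strengthen Ψ⊨Φ A≤C) (≤-strengthen Ψ⊨Φ B≤D)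
≤-strengthen Ψ⊨Φ (⊸≤ C≤A B≤D) = ⊸≤ (≤-strengthen Ψ⊨Φ C≤A) (≤-strengthen Ψ⊨Φ B≤D)
≤-strengthen Ψ⊨Φ (∀ᵃ≤ A≤B) = ∀ᵃ≤ (≤-strengthen Ψ⊨Φ A≤B)
≤-strengthen Ψ⊨Φ (!≤ {p = p} {q} q⊑p A≤B) =
  !≤ (⊨-trans {c = q ≤ᶜ p} Ψ⊨Φ q⊑p) (≤-strengthen (⊨*-under-same 1 _ Ψ⊨Φ) A≤B)
≤-strengthen Ψ⊨Φ (∀ᶠ≤ {k = k} {Θ = Θ} ⊨Ψ' A≤B) =
  ∀ᶠ≤ (⊨*-trans Ψ₊⊨Φ₊ ⊨Ψ') (≤-strengthen Ψ₊⊨Φ₊ A≤B)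
  where Ψ₊⊨Φ₊ = ⊨*-under-same k Θ Ψ⊨Φ
≤-strengthen Ψ⊨Φ (∃ᶠ≤ {k = k} {Ψ = Θ} ⊨Θ' A≤B) =
  ∃ᶠ≤ (⊨*-trans Ψ₊⊨Φ₊ ⊨Θ') (≤-strengthen Ψ₊⊨Φ₊ A≤B)
  where Ψ₊⊨Φ₊ = ⊨*-under-same k Θ Ψ⊨Φ

-- The two derivations live in different contexts as soon as they pass a
-- binder (e.g. x < q versus x < r under !), so transitivity is proved for
-- derivations over any two constraint sets entailed by the target one.
≤-trans-⊨ : ∀ {Γ} {A B C : Formula Γ} {Φ Φ' Ψ} → Ψ ⊨* Φ → Ψ ⊨* Φ' →
            A ≤[ Φ ] B → B ≤[ Φ' ] C → A ≤[ Ψ ] C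
≤-trans-⊨ e e' (atom≤ ps⊑qs) (atom≤ qs⊑rs) =
  atom≤ (Pointwise.trans (λ {p} {q} {r} p⊑q q⊑r →
                            ⊑-trans {p = p} {q} {r} (⊨-trans {c = p ≤ᶜ q} e p⊑q)
                                                    (⊨-trans {c = q ≤ᶜ r} e' q⊑r))
                         ps⊑qs qs⊑rs)
≤-trans-⊨ e e' (⊗≤ A≤C B≤D) (⊗≤ C≤E D≤F) =
  ⊗≤ (≤-trans-⊨ e e' A≤C C≤E) (≤-trans-⊨ e e' B≤D D≤F)
≤-trans-⊨ e e' (⊸≤ C≤A B≤D) (⊸≤ E≤C D≤F) =
  ⊸≤ (≤-trans-⊨ e' e E≤C C≤A) (≤-trans-⊨ e e' B≤D D≤F)
≤-trans-⊨ e e' (∀ᵃ≤ A≤B) (∀ᵃ≤ B≤C) = ∀ᵃ≤ (≤-trans-⊨ e e' A≤B B≤C)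
≤-trans-⊨ e e' (!≤ {p = p} {q} q⊑p A≤B) (!≤ {q = r} r⊑q B≤C) =
  !≤ (⊑-trans {p = r} {q} {p} r⊑q′ (⊨-trans {c = q ≤ᶜ p} e q⊑p))
     (≤-trans-⊨ (⊨*-under 1 e (<-bound-mono {r = r} {q} r⊑q′))
                (⊨*-under-same 1 _ e') A≤B B≤C)
  where r⊑q′ = ⊨-trans {c = r ≤ᶜ q} e' r⊑q
≤-trans-⊨ e e' (∀ᶠ≤ {k = k} ⊨Ψ₁ A≤B) (∀ᶠ≤ {Θ = Ξ} ⊨Θ B≤C) =
  ∀ᶠ≤ (⊨*-trans Ψ₊⊨Φ₊ ⊨Ψ₁) (≤-trans-⊨ Ψ₊⊨Φ₊ Ψ₊⊨Φ'₊ A≤B B≤C)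
  where
  Ψ₊⊨Φ'₊ = ⊨*-under-same k Ξ e'
  Ψ₊⊨Φ₊  = ⊨*-under k e (⊨*-trans Ψ₊⊨Φ'₊ ⊨Θ)
≤-trans-⊨ e e' (∃ᶠ≤ {k = k} {Ψ = Ψ₁} ⊨Θ A≤B) (∃ᶠ≤ ⊨Ξ B≤C) =
  ∃ᶠ≤ (⊨*-trans Ψ₊⊨Φ'₊ ⊨Ξ) (≤-trans-⊨ Ψ₊⊨Φ₊ Ψ₊⊨Φ'₊ A≤B B≤C)
  where
  Ψ₊⊨Φ₊  = ⊨*-under-same k Ψ₁ e
  Ψ₊⊨Φ'₊ = ⊨*-under k e' (⊨*-trans Ψ₊⊨Φ₊ ⊨Θ)

≤-trans : ∀ {Γ} {A B C : Formula Γ} {Φ} → A ≤[ Φ ] B → B ≤[ Φ ] C → A ≤[ Φ ] C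
≤-trans {Φ = Φ} = ≤-trans-⊨ (⊨*-refl Φ) (⊨*-refl Φ)

lemma2p9 : ((Γ : List ℕ) (A B : Formula Γ) (Φ Ψ : Constraints) →
               WF A → WF B → WFCs Φ → WFCs Ψ →
               A ≤[ Φ ] B → Ψ ⊨* Φ → A ≤[ Ψ ] B)
             × ((Γ : List ℕ) (A B C : Formula Γ) (Φ : Constraints) →
               WF A → WF B → WF C → WFCs Φ →
               A ≤[ Φ ] B → B ≤[ Φ ] C → A ≤[ Φ ] C)
lemma2p9 = (λ _ _ _ _ _ _ _ _ _ A≤B Ψ⊨Φ → ≤-strengthen Ψ⊨Φ A≤B)
         , (λ _ _ _ _ _ _ _ _ _ A≤B B≤C → ≤-trans A≤B B≤C)
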